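{- Fix any finite sequence $X=x_1,\dots,x_m$ of pairing-heap operations executed on an initially empty collection of pairing heaps, and let $\Phi_0,\dots,\Phi_m$ be the potential defined in the context. If $x_i$ is a Make-Heap, then $a_i+\Phi_i-\Phi_{i-1}\le 21$.
   Context: A pairing heap is a heap-ordered (min-heap) rooted ordered tree. Pairing two trees makes the root with the larger key the new leftmost child of the other root. Make-Heap creates a new single-node heap; Meld pairs two roots; Insert creates a node and pairs it with the root; Decrease-Key cuts a non-root node with its subtree, decreases its key and pairs it with the root; Delete cuts a node and its subtree, performs Extract-Min on that subtree and pairs the result with the root; Extract-Min removes the root, pairs its children left to right in pairs (first with second, third with fourth, ...), then repeatedly pairs the two rightmost remaining trees until one remains. The actual cost $a_i$ of $x_i$ is the number of pairings it performs plus $1$; $n_i$ is the size of the heap $x_i$ acted upon after $x_i$. Binary representation: each node's left child is its leftmost child and its right child is its immediate right sibling. A node is black if it remains in the collection of heaps at the end of $X$, white otherwise. For a node $x$, $s(x)$ is the number of white nodes in the subtree of $x$ in the binary representation (including $x$). A white node is heavy if the number of white nodes in its left binary subtree is at least the number in its right binary subtree, and light otherwise. A node is captured if its parent (in the heap tree) exists and is black. Node potential of a white node $x$: rank potential $18\log_2 s(x)$; plus triple-white potential $0$ if $x$ has an immediate left sibling and an immediate right sibling that are both white, and $6$ otherwise; plus weight potential $0$ if heavy and $6$ if light; plus capture potential $0$ if captured and $6$ otherwise. The node potential of a black node is only its capture potential ($0$ if captured, $6$ otherwise). Each heap with $k$ white nodes has heap potential $8-36\sum_{j=1}^{k}\log_2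 j$. $\Phi_i$ is the sum of all node potentials and heap potentials in the collection after executing $x_i$ ($\Phi_0=0$). -}

module Defs where

open import Data.Nat using (ℕ; zero; suc; _+_; _*_; _^_; _≤_; _!; _<ᵇ_; _≤ᵇ_; _≡ᵇ_)
open import Data.Bool using (Bool; true; false; if_then_else_; not; _∧_; _∨_)
open import Data.List using (List; []; _∷_; _++_; [_])
open import Data.Maybe using (Maybe; just; nothing)
open import Data.Product using (_×_; _,_)

-- Nodes are identified by their creation number; keys are natural numbers.
Id : Set
Id = ℕ

Key : Set
Key = ℕ

-- The heaps are stored directly in their BINARY REPRESENTATION:
-- the left child of a node is its leftmost (heap) child, the right child
-- is its immediate right sibling.  A heap is either empty ('leaf') or a
-- 'bnode' whose right binary subtree is 'leaf' (the root has no siblings).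
data BT : Set where
  leaf  : BT
  bnode : (x : Id) (k : Key) (l r : BT) → BT

-- A collection of pairing heaps (an emptied heap stays as 'leaf'),
-- together with the counter used to name fresh nodes.
record State : Set where
  constructor st
  field
    counter : ℕ
    heaps   : List BT
open State public

initState : State
initState = st 0 []

-- The pairing-heap operations.  Heaps are referred to by their position
-- in the collection, nodes by their identifier.
data Op : Set where
  makeHeap    : Key → Op
  meld        : ℕ → ℕ → Op
  insert      : ℕ → Key → Op
  decreaseKey : Id → Key → Op
  delete      : Id → Op
  extractMin  : ℕ → Op

-- Pair two roots: the root with the larger key becomes the new leftmost
-- child of the other (ties: the second becomes the child of the first).
pair : BT → BT → BT
pair leaf u = u
pair (bnode a ka la ra) leaf = bnode a ka la ra
pair (bnode a ka la ra) (bnode b kb lb rb) =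
  if kb <ᵇ ka then bnode b kb (bnode a ka la lb) leaf
              else bnode a ka (bnode b kb lb la) leaf

-- Pairing together with the number of pairings performed (pairing with an
-- empty heap is not a pairing).
pairC : BT → BT → ℕ × BT
pairC leaf u = 0 , u
pairC t@(bnode _ _ _ _) leaf = 0 , t
pairC t@(bnode _ _ _ _) u@(bnode _ _ _ _) = 1 , pair t u

children : BT → List BT
children leaf = []
children (bnode x k l r) = bnode x k l leaf ∷ children r

pass1 : List BT → ℕ × List BT
pass1 [] = 0 , []
pass1 (t ∷ []) = 0 , (t ∷ [])
pass1 (t ∷ u ∷ ts) with pass1 ts
... | c , ts' with pairC t u
... | p , v = p + c , (v ∷ ts')

pass2 : List BT → ℕ × BT
pass2 [] = 0 , leaf
pass2 (t ∷ ts) with pass2 ts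
... | c , u with pairC t u
... | p , v = p + c , v

extractMinT : BT → ℕ × BT
extractMinT leaf = 0 , leaf
extractMinT (bnode x k l r) with pass1 (children l)
... | c₁ , ts with pass2 ts
... | c₂ , h = c₁ + c₂ , h

-- Cut the node x together with its (heap) subtree out of a binary subtree:
-- returns the remaining binary subtree (x replaced by its right sibling
-- chain) and the cut-out heap rooted at x.
cutFrom : Id → BT → Maybe (BT × BT)
cutFrom x leaf = nothing
cutFrom x (bnode y k l r) with x ≡ᵇ y
... | true = just (r , bnode y k l leaf)
... | false with cutFrom x l
...   | just (l' , t) = just (bnode y k l' r , t)
...   | nothing with cutFrom x r
...     | just (r' , t) = just (bnode y k l r' , t)
...     | nothing = nothing

setKey : Key → BT → BT
setKey k' leaf = leaf
setKey k' (bnode x k l r) = bnode x k' l r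

keyIn : Id → BT → Maybe Key
keyIn x leaf = nothing
keyIn x (bnode y k l r) with x ≡ᵇ y
... | true = just k
... | false with keyIn x l
...   | just k' = just k'
...   | nothing = keyIn x r

keyOf : Id → List BT → Maybe Key
keyOf x [] = nothing
keyOf x (h ∷ hs) with keyIn x h
... | just k = just k
... | nothing = keyOf x hs

decKeyHeap : Id → Key → BT → Maybe (ℕ × BT)
decKeyHeap x k' leaf = nothing
decKeyHeap x k' (bnode y k l r) with x ≡ᵇ y
... | true = just (0 , bnode y k' l r)
... | false with cutFrom x l
...   | nothing = nothing
...   | just (l' , t) = just (pairC (bnode y k l' r) (setKey k' t))

deleteHeap : Id → BT → Maybe (ℕ × BT)
deleteHeap x leaf = nothing
deleteHeap x (bnode y k l r) with x ≡ᵇ y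
... | true = just (extractMinT (bnode y k l r))
... | false with cutFrom x l
...   | nothing = nothing
...   | just (l' , t) with extractMinT t
...     | c , t' with pairC (bnode y k l' r) t'
...       | p , h = just (c + p , h)

updateFirst : (BT → Maybe (ℕ × BT)) → List BT → Maybe (ℕ × List BT)
updateFirst f [] = nothing
updateFirst f (h ∷ hs) with f h
... | just (c , h') = just (c , (h' ∷ hs))
... | nothing with updateFirst f hs
...   | nothing = nothing
...   | just (c , hs') = just (c , (h ∷ hs'))

lookupM : List BT → ℕ → Maybe BT
lookupM [] i = nothing
lookupM (h ∷ hs) zero = just h
lookupM (h ∷ hs) (suc i) = lookupM hs i

setAt : List BT → ℕ → BT → List BT
setAt [] i b = []
setAt (h ∷ hs) zero b = b ∷ hs
setAt (h ∷ hs) (suc i) b = h ∷ setAt hs i b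

-- One operation: returns (actual cost a = #pairings + 1, new state), or
-- nothing if the operation is not applicable (invalid sequence).
step : State → Op → Maybe (ℕ × State)
step (st c hs) (makeHeap k) = just (1 , st (suc c) (hs ++ [ bnode c k leaf leaf ]))
step (st c hs) (insert i k) with lookupM hs i
... | nothing = nothing
... | just h with pairC h (bnode c k leaf leaf)
...   | p , h' = just (suc p , st (suc c) (setAt hs i h'))
step (st c hs) (meld i j) = meldStep (i ≡ᵇ j) (lookupM hs i) (lookupM hs j)
  where
    meldStep : Bool → Maybe BT → Maybe BT → Maybe (ℕ × State)
    meldStep false (just h₁) (just h₂) with pairC h₁ h₂
    ... | p , h = just (suc p , st c (setAt (setAt hs i h) j leaf))
    meldStep _ _ _ = nothing
step (st c hs) (extractMin i) = emStep (lookupM hs i)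
  where
    emStep : Maybe BT → Maybe (ℕ × State)
    emStep (just h@(bnode _ _ _ _)) with extractMinT h
    ... | p , h' = just (suc p , st c (setAt hs i h'))
    emStep _ = nothing
step (st c hs) (decreaseKey x k') with keyOf x hs
... | nothing = nothing
... | just k with k' ≤ᵇ k
...   | false = nothing
...   | true with updateFirst (decKeyHeap x k') hs
...     | nothing = nothing
...     | just (p , hs') = just (suc p , st c hs')
step (st c hs) (delete x) with updateFirst (deleteHeap x) hs
... | nothing = nothing
... | just (p , hs') = just (suc p , st c hs')

run : State → List Op → Maybe State
run s [] = just s
run s (o ∷ os) with step s o
... | nothing = nothing
... | just (_ , s') = run s' os

memBT : Id → BT → Bool
memBT x leaf = false
memBT x (bnode y k l r) = (x ≡ᵇ y) ∨ memBT x l ∨ memBT x r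

memHeaps : Id → List BT → Bool
memHeaps x [] = false
memHeaps x (h ∷ hs) = memBT x h ∨ memHeaps x hs

isWhite : State → Id → Bool
isWhite fin x = not (memHeaps x (heaps fin))

wc : (Id → Bool) → BT → ℕ
wc w leaf = 0
wc w (bnode x k l r) = (if w x then 1 else 0) + wc w l + wc w r

-- A potential value  A + log₂ N − log₂ D  with A, N, D natural numbers
-- (N, D ≥ 1).  Since the paper's potential is a sum of natural constants,
-- terms 18·log₂ s(x) and terms −36·log₂ j, it is always of this form.
record Pot : Set where
  constructor pot
  field
    A : ℕ
    N : ℕ
    D : ℕ
open Pot public

_⊕_ : Pot → Pot → Pot
pot a n d ⊕ pot a' n' d' = pot (a + a') (n * n') (d * d')

zeroPot : Pot
zeroPot = pot 0 1 1

whiteJust : (Id → Bool) → Maybe Id → Bool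
whiteJust w nothing = false
whiteJust w (just y) = w y

rootWhite : (Id → Bool) → BT → Bool
rootWhite w leaf = false
rootWhite w (bnode z _ _ _) = w z

capturedP : (Id → Bool) → Maybe Id → Bool
capturedP w nothing = false
capturedP w (just p) = not (w p)

-- Node potentials of all nodes of a binary subtree.
-- hp = heap parent of the root of the binary subtree,
-- ls = immediate left sibling of the root of the binary subtree.
nodePots : (Id → Bool) → (hp ls : Maybe Id) → BT → Pot
nodePots w hp ls leaf = zeroPot
nodePots w hp ls (bnode x k l r) =
  own ⊕ (nodePots w (just x) nothing l ⊕ nodePots w hp (just x) r)
  where
    capture : ℕ
    capture = if capturedP w hp then 0 else 6
    s : ℕ
    s = wc w (bnode x k l r)
    triple : ℕ
    triple = if whiteJust w ls ∧ rootWhite w r then 0 else 6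
    weight : ℕ
    weight = if wc w r ≤ᵇ wc w l then 0 else 6
    own : Pot
    own = if w x then pot (triple + weight + capture) (s ^ 18) 1
                 else pot capture 1 1

-- heap potential  8 − 36 Σ_{j=1}^{k} log₂ j = 8 − 36 log₂ (k !)
-- plus node potentials; an empty heap contributes nothing.
heapPot : (Id → Bool) → BT → Pot
heapPot w leaf = zeroPot
heapPot w h@(bnode _ _ _ _) = pot 8 1 ((wc w h !) ^ 36) ⊕ nodePots w nothing nothing h

Φ : (Id → Bool) → State → Pot
Φ w s = go (heaps s)
  where
    go : List BT → Pot
    go [] = zeroPot
    go (h ∷ hs) = heapPot w h ⊕ go hs

-- a + Φ' − Φ ≤ b, with Φ = A + log₂ N − log₂ D, Φ' = A' + log₂ N' − log₂ D',
-- written exactly (exponentiating):  2^(a + A') N' D ≤ 2^(b + A) N D'.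
AmortizedLE : ℕ → Pot → Pot → ℕ → Set
AmortizedLE a P P' b = 2 ^ (a + A P') * N P' * D P ≤ 2 ^ (b + A P) * N P * D P'

module Submission where

open import Defs
open import Data.Bool using (Bool; true; false; if_then_else_)
open import Data.Nat using (ℕ; suc; s≤s; _+_; _≤_)
open import Data.Nat.Properties
open import Data.List using (List; []; _∷_; _++_; [_])
open import Data.Maybe using (just)
open import Data.Product using (_,_)
open import Relation.Binary.PropositionalEquality hiding ([_])

⊕-identityˡ : ∀ P → zeroPot ⊕ P ≡ P
⊕-identityˡ (pot a n d) rewrite *-identityˡ n | *-identityˡ d = refl

⊕-identityʳ : ∀ P → P ⊕ zeroPot ≡ P
⊕-identityʳ (pot a n d) rewrite +-identityʳ a | *-identityʳ n | *-identityʳ d = refl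

⊕-assoc : ∀ P Q R → (P ⊕ Q) ⊕ R ≡ P ⊕ (Q ⊕ R)
⊕-assoc (pot a n d) (pot a' n' d') (pot a'' n'' d'')
  rewrite +-assoc a a' a'' | *-assoc n n' n'' | *-assoc d d' d'' = refl

Φ-snoc : ∀ w c c' hs t → Φ w (st c' (hs ++ [ t ])) ≡ Φ w (st c hs) ⊕ heapPot w t
Φ-snoc w c c' [] t = trans (⊕-identityʳ (heapPot w t)) (sym (⊕-identityˡ (heapPot w t)))
Φ-snoc w c c' (h ∷ hs) t = begin
  heapPot w h ⊕ Φ w (st c' (hs ++ [ t ]))   ≡⟨ cong (heapPot w h ⊕_) (Φ-snoc w c c' hs t) ⟩
  heapPot w h ⊕ (Φ w (st c hs) ⊕ heapPot w t) ≡⟨ sym (⊕-assoc (heapPot w h) _ _) ⟩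
  (heapPot w h ⊕ Φ w (st c hs)) ⊕ heapPot w t ∎
  where open ≡-Reasoning

-- A white singleton pays 8 (heap) + 6 (triple-white) + 6 (capture); its rank
-- and weight terms vanish.  A black one pays 8 + 6 (capture).
heapPot-singleton : ∀ w x k → heapPot w (bnode x k leaf leaf) ≡ pot (if w x then 20 else 14) 1 1
heapPot-singleton w x k with w x
... | true  = refl
... | false = refl

singletonPot≤20 : ∀ (b : Bool) → (if b then 20 else 14) ≤ 20
singletonPot≤20 true  = ≤-refl
singletonPot≤20 false = m≤m+n 14 6

amortized-⊕-constant : ∀ a b P P' e → P' ≡ P ⊕ pot e 1 1 → a + e ≤ b → AmortizedLE a P P' b
amortized-⊕-constant a b (pot A₀ n d) _ e refl a+e≤b
  rewrite *-identityʳ n | *-identityʳ d =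
    *-monoˡ-≤ d (*-monoˡ-≤ n (^-monoʳ-≤ 2 exponent≤))
  where
  exponent≤ : a + (A₀ + e) ≤ b + A₀
  exponent≤ = begin
    a + (A₀ + e) ≡⟨ cong (a +_) (+-comm A₀ e) ⟩
    a + (e + A₀) ≡⟨ sym (+-assoc a e A₀) ⟩
    a + e + A₀   ≤⟨ +-monoˡ-≤ A₀ a+e≤b ⟩
    b + A₀       ∎
    where open ≤-Reasoning

lemma2 : (pre post : List Op) (k : Key) (fin : State) →
    run initState (pre ++ makeHeap k ∷ post) ≡ just fin →
    (s s' : State) (a : ℕ) →
    run initState pre ≡ just s →
    step s (makeHeap k) ≡ just (a , s') →
    AmortizedLE a (Φ (isWhite fin) s) (Φ (isWhite fin) s') 21
-- The old potential is passed explicitly: inferring it from the goal makes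
-- Agda unfold 2 ^ (21 + …) during unification.
lemma2 pre post k fin _ (st c hs) _ _ _ refl =
  amortized-⊕-constant 1 21 (Φ (isWhite fin) (st c hs)) _ (if isWhite fin c then 20 else 14)
    (trans (Φ-snoc (isWhite fin) c (suc c) hs (bnode c k leaf leaf))
           (cong (Φ (isWhite fin) (st c hs) ⊕_) (heapPot-singleton (isWhite fin) c k)))
    (s≤s (singletonPot≤20 (isWhite fin c)))
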